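{- In the setting described in the context, let $A\in\mathcal{A}$ be an isolated vertex of $\widehat{H}$ and let $z=z(A)$. Then $G$ has no chordless cycle that contains the edge $\{v,z\}$.
   Context: Let $G$ be a finite simple undirected graph; a chordless cycle is an induced cycle on at least four vertices, and a graph is chordal if it has none. Let $E_I,E_M\subseteq E(G)$ and for $u\in V(G)$ let $N^R_G(u)=\{w\in N_G(u):\{u,w\}\notin E_I\cup E_M\}$. Fix $v\in V(G)$ and a set $B_v\subseteq V(G)\setminus\{v\}$ such that $G\setminus B_v$ is chordal. Let $I$ be an independent set of $G$ with $I\subseteq N^R_G(v)\setminus B_v$. Let $X=N_G(v)\setminus(B_v\cup I)$, let $H=G\setminus(\{v\}\cup B_v\cup X)$, and let $\mathcal{A}$ be the set of connected components of $H$ that contain at least one vertex of $I$. Each $A\in\mathcal{A}$ contains exactly one vertex of $I$, denoted $z(A)$. For a vertex set $U$, $N_G(U)=\bigcup_{u\in U}N_G(u)$. Let $B_c=B_v\cap N_G(v)$ and $B_f=B_v\setminus B_c$. The bipartite graph $\widehat{H}$ has vertex set $\mathcal{A}\cup B_v$ (each component $A$ is a single vertex); for $b\in B_c$ and $A\in\mathcal{A}$, $\{b,A\}\in E(\widehat{H})$ iff $b\in N_G(V(A))\setminus N_G(z(A))$; for $b\in B_f$ and $A\in\mathcal{A}$, $\{b,A\}\in E(\widehat{H})$ iff $b\in N_G(V(A))$. -}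

module Defs where

open import Data.Nat using (ℕ; zero; suc; _+_)
open import Data.Nat.DivMod using (_%_)
open import Data.Fin using (Fin; toℕ)
open import Data.Fin.Subset using (Subset; _∈_; _∉_)
open import Data.Bool using (Bool; true; false)
open import Data.Product using (Σ; ∃; _×_; _,_)
open import Data.Sum using (_⊎_)
open import Data.Unit using (⊤)
open import Relation.Nullary using (¬_)
open import Relation.Binary.PropositionalEquality using (_≡_; _≢_)

record Graph (n : ℕ) : Set where
  field
    E      : Fin n → Fin n → Bool
    sym    : ∀ u w → E u w ≡ E w u
    irrefl : ∀ u → E u u ≡ false

open Graph public

Adj : ∀ {n} → Graph n → Fin n → Fin n → Set
Adj G u w = E G u w ≡ true

-- a set of (undirected) edges, given by a Bool-valued relation;
-- the unordered edge {u,w} belongs to it iff either orientation is marked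
EdgeSet : ℕ → Set
EdgeSet n = Fin n → Fin n → Bool

InE : ∀ {n} → EdgeSet n → Fin n → Fin n → Set
InE F u w = (F u w ≡ true) ⊎ (F w u ≡ true)

EdgesOf : ∀ {n} → EdgeSet n → Graph n → Set
EdgesOf F G = ∀ u w → F u w ≡ true → Adj G u w

NR : ∀ {n} → Graph n → EdgeSet n → EdgeSet n → Fin n → Fin n → Set
NR G EI EM u w = Adj G u w × ¬ InE EI u w × ¬ InE EM u w

Independent : ∀ {n} → Graph n → Subset n → Set
Independent G I = ∀ u w → u ∈ I → w ∈ I → ¬ Adj G u w

Consec : ∀ {k} → Fin (suc k) → Fin (suc k) → Set
Consec {k} i j = (toℕ j ≡ suc (toℕ i) % suc k) ⊎ (toℕ i ≡ suc (toℕ j) % suc k)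

record ChordlessCycle {n} (G : Graph n) (S : Fin n → Set) : Set where
  field
    m     : ℕ
    c     : Fin (4 + m) → Fin n
    inj   : ∀ i j → c i ≡ c j → i ≡ j
    inS   : ∀ i → S (c i)
    adj⇒  : ∀ i j → Adj G (c i) (c j) → Consec i j
    ⇒adj  : ∀ i j → Consec i j → Adj G (c i) (c j)

open ChordlessCycle public

Chordal : ∀ {n} → Graph n → (Fin n → Set) → Set
Chordal G S = ¬ ChordlessCycle G S

ChordlessCycleThroughEdge : ∀ {n} → Graph n → Fin n → Fin n → Set
ChordlessCycleThroughEdge G u w =
  Σ (ChordlessCycle G (λ _ → ⊤)) λ C →
    ∃ λ i → ∃ λ j → Consec i j × c C i ≡ u × c C j ≡ w

data Walk {n} (G : Graph n) (S : Fin n → Set) : Fin n → Fin n → Set where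
  here : ∀ {u} → S u → Walk G S u u
  step : ∀ {u w x} → S u → Adj G u w → Walk G S w x → Walk G S u x

record Component {n} (G : Graph n) (S : Fin n → Set) (A : Subset n) : Set where
  field
    nonempty  : ∃ λ a → a ∈ A
    sub       : ∀ a → a ∈ A → S a
    connected : ∀ a b → a ∈ A → b ∈ A → Walk G (λ x → x ∈ A) a b
    closed    : ∀ a b → a ∈ A → S b → Adj G a b → b ∈ A

InX : ∀ {n} → Graph n → Fin n → Subset n → Subset n → Fin n → Set
InX G v Bv I u = Adj G v u × u ∉ Bv × u ∉ I

InH : ∀ {n} → Graph n → Fin n → Subset n → Subset n → Fin n → Set
InH G v Bv I u = u ≢ v × u ∉ Bv × ¬ InX G v Bv I u

InNbhdOf : ∀ {n} → Graph n → Subset n → Fin n → Set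
InNbhdOf G A b = ∃ λ a → a ∈ A × Adj G a b

-- edges of Ĥ at the vertex A (with z = z(A))
HatEdge : ∀ {n} → Graph n → Fin n → Subset n → Subset n → Fin n → Fin n → Set
HatEdge G v Bv A z b =
  (b ∈ Bv × Adj G v b × InNbhdOf G A b × ¬ Adj G z b)
  ⊎ (b ∈ Bv × ¬ Adj G v b × InNbhdOf G A b)

IsolatedInHhat : ∀ {n} → Graph n → Fin n → Subset n → Subset n → Fin n → Set
IsolatedInHhat G v Bv A z = ∀ b → ¬ HatEdge G v Bv A z b

-- After a symmetry of the cycle we may assume v = c₀ and z = c₁ on a chordless
-- cycle c₀ … c_{L-1}.  Then c₁, c₂, …, c_{L-2} all lie in A: each of them is a
-- non-neighbour of v, so if it left A it would either lie in H (contradicting that A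
-- is a component) or in B_v ∖ N(v) next to A (a B_f-edge of A in Ĥ).  The last vertex
-- c_{L-1} is adjacent to v and to c_{L-2} ∈ A but not to z = c₁, so it cannot be in
-- B_v either (that would be a B_c-edge).  Hence the cycle avoids B_v, contradicting
-- the chordality of G ∖ B_v.
module Submission where

open import Defs
open import Data.Empty using (⊥-elim)
open import Data.Fin using (Fin; zero; suc; toℕ; fromℕ; fromℕ<; inject₁; opposite)
open import Data.Fin.Induction using (<-weakInduction)
open import Data.Fin.Properties
  using (0≢1+n; toℕ-fromℕ<; toℕ-fromℕ; toℕ-inject₁; toℕ-injective; toℕ<n; opposite-prop; opposite-involutive)
open import Data.Fin.Relation.Unary.Top using (view; ‵fromℕ; ‵inject₁)
open import Data.Fin.Subset using (Subset; _∈_; _∉_)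
open import Data.Fin.Subset.Properties using (_∈?_)
open import Data.Nat using (ℕ; suc; _+_; _∸_; _<_; s≤s; NonZero)
open import Data.Nat.DivMod using (_%_; %-distribˡ-+; m%n%n≡m%n; m%n<n; m<n⇒m%n≡m; m≤n⇒m%n≡m; n%n≡0; [m+n]%n≡m%n)
open import Data.Nat.Properties using (+-comm; +-assoc; +-identityʳ; +-∸-assoc; m≤n⇒m<n∨m≡n; m∸n+n≡m; m∸n≤m; n∸n≡0; <⇒≤)
open import Data.Product using (Σ; _×_; _,_; proj₁; proj₂)
open import Data.Sum using (inj₁; inj₂; swap) renaming (map to map-⊎)
open import Relation.Nullary using (¬_; yes; no)
open import Function using (_∘_)
open import Relation.Binary.PropositionalEquality
  using (_≡_; _≢_; refl; trans; cong; subst; subst₂; module ≡-Reasoning)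
  renaming (sym to ≡-sym)

[m+n%d]%d≡[m+n]%d : ∀ m n d .{{_ : NonZero d}} → (m + n % d) % d ≡ (m + n) % d
[m+n%d]%d≡[m+n]%d m n d = begin
  (m + n % d) % d             ≡⟨ %-distribˡ-+ m (n % d) d ⟩
  (m % d + n % d % d) % d     ≡⟨ cong (λ k → (m % d + k) % d) (m%n%n≡m%n n d) ⟩
  (m % d + n % d) % d         ≡⟨ %-distribˡ-+ m n d ⟨
  (m + n) % d                 ∎
  where open ≡-Reasoning

Next : ∀ {k} → Fin (suc k) → Fin (suc k) → Set
Next {k} i j = toℕ j ≡ suc (toℕ i) % suc k

record CycleSymmetry (k : ℕ) : Set where
  field
    to from     : Fin (suc k) → Fin (suc k)
    from-to     : ∀ x → from (to x) ≡ x
    to-consec   : ∀ {x y} → Consec x y → Consec (to x) (to y)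
    from-consec : ∀ {x y} → Consec x y → Consec (from x) (from y)

rotate : ∀ {k} → ℕ → Fin (suc k) → Fin (suc k)
rotate {k} r x = fromℕ< (m%n<n (r + toℕ x) (suc k))

module _ {k : ℕ} where

  private
    N : ℕ
    N = suc k

  toℕ-rotate : ∀ r (x : Fin N) → toℕ (rotate r x) ≡ (r + toℕ x) % N
  toℕ-rotate r x = toℕ-fromℕ< _

  rotate-next : ∀ r {x y : Fin N} → Next x y → Next (rotate r x) (rotate r y)
  rotate-next r {x} {y} y≡1+x = begin
    toℕ (rotate r y)              ≡⟨ toℕ-rotate r y ⟩
    (r + toℕ y) % N               ≡⟨ cong (λ t → (r + t) % N) y≡1+x ⟩
    (r + suc (toℕ x) % N) % N     ≡⟨ [m+n%d]%d≡[m+n]%d r (suc (toℕ x)) N ⟩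
    (r + suc (toℕ x)) % N         ≡⟨ cong (_% N) (+-comm r (suc (toℕ x))) ⟩
    (1 + (toℕ x + r)) % N         ≡⟨ cong (λ t → (1 + t) % N) (+-comm (toℕ x) r) ⟩
    (1 + (r + toℕ x)) % N         ≡⟨ [m+n%d]%d≡[m+n]%d 1 (r + toℕ x) N ⟨
    suc ((r + toℕ x) % N) % N     ≡⟨ cong (λ t → suc t % N) (toℕ-rotate r x) ⟨
    suc (toℕ (rotate r x)) % N    ∎
    where open ≡-Reasoning

  rotate-consec : ∀ r {x y : Fin N} → Consec x y → Consec (rotate r x) (rotate r y)
  rotate-consec r = map-⊎ (rotate-next r) (rotate-next r)

  rotate-cancel : ∀ r s → s + r ≡ N → (x : Fin N) → rotate s (rotate r x) ≡ x
  rotate-cancel r s s+r≡N x = toℕ-injective (begin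
    toℕ (rotate s (rotate r x))   ≡⟨ toℕ-rotate s (rotate r x) ⟩
    (s + toℕ (rotate r x)) % N    ≡⟨ cong (λ t → (s + t) % N) (toℕ-rotate r x) ⟩
    (s + (r + toℕ x) % N) % N     ≡⟨ [m+n%d]%d≡[m+n]%d s (r + toℕ x) N ⟩
    (s + (r + toℕ x)) % N         ≡⟨ cong (_% N) (+-assoc s r (toℕ x)) ⟨
    (s + r + toℕ x) % N           ≡⟨ cong (λ t → (t + toℕ x) % N) s+r≡N ⟩
    (N + toℕ x) % N               ≡⟨ cong (_% N) (+-comm N (toℕ x)) ⟩
    (toℕ x + N) % N               ≡⟨ [m+n]%n≡m%n (toℕ x) N ⟩
    toℕ x % N                     ≡⟨ m<n⇒m%n≡m (toℕ<n x) ⟩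
    toℕ x                         ∎)
    where open ≡-Reasoning

  rotation : Fin N → CycleSymmetry k
  rotation i = record
    { to          = rotate (toℕ i)
    ; from        = rotate (N ∸ toℕ i)
    ; from-to     = rotate-cancel (toℕ i) (N ∸ toℕ i) (m∸n+n≡m (<⇒≤ (toℕ<n i)))
    ; to-consec   = rotate-consec (toℕ i)
    ; from-consec = rotate-consec (N ∸ toℕ i)
    }

  opposite-next : ∀ {x y : Fin N} → Next x y → Next (opposite y) (opposite x)
  opposite-next {x} {y} y≡1+x = begin
    toℕ (opposite x)             ≡⟨ opposite-prop x ⟩
    k ∸ toℕ x                    ≡⟨ ∸-reverses-successor (toℕ<n x) y≡1+x ⟩
    suc (k ∸ toℕ y) % N          ≡⟨ cong (λ t → suc t % N) (opposite-prop y) ⟨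
    suc (toℕ (opposite y)) % N   ∎
    where
      open ≡-Reasoning
      ∸-reverses-successor : ∀ {a b} → a < N → b ≡ suc a % N → k ∸ a ≡ suc (k ∸ b) % N
      ∸-reverses-successor {a} {b} (s≤s a≤k) b≡1+a with m≤n⇒m<n∨m≡n a≤k
      ... | inj₁ a<k = begin
        k ∸ a                   ≡⟨ m≤n⇒m%n≡m (m∸n≤m k a) ⟨
        (k ∸ a) % N             ≡⟨ cong (_% N) (+-∸-assoc 1 a<k) ⟩
        suc (k ∸ suc a) % N     ≡⟨ cong (λ t → suc (k ∸ t) % N) (trans b≡1+a (m<n⇒m%n≡m (s≤s a<k))) ⟨
        suc (k ∸ b) % N         ∎
      ... | inj₂ refl = begin
        k ∸ k                   ≡⟨ n∸n≡0 k ⟩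
        0                       ≡⟨ n%n≡0 N ⟨
        N % N                   ≡⟨ cong (λ t → suc (k ∸ t) % N) (trans b≡1+a (n%n≡0 N)) ⟨
        suc (k ∸ b) % N         ∎

  reflection : CycleSymmetry k
  reflection = record
    { to          = opposite
    ; from        = opposite
    ; from-to     = opposite-involutive
    ; to-consec   = reverse
    ; from-consec = reverse
    }
    where
      reverse : ∀ {x y} → Consec x y → Consec (opposite x) (opposite y)
      reverse = swap ∘ map-⊎ opposite-next opposite-next

module _ {n} {G : Graph n} {S : Fin n → Set} where

  reindex : (C : ChordlessCycle G S) → CycleSymmetry (3 + m C) → ChordlessCycle G S
  reindex C σ = record
    { m    = m C
    ; c    = c C ∘ to
    ; inj  = λ x y e → trans (≡-sym (from-to x)) (trans (cong from (inj C _ _ e)) (from-to y))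
    ; inS  = inS C ∘ to
    ; adj⇒ = λ x y a → subst₂ Consec (from-to x) (from-to y) (from-consec (adj⇒ C _ _ a))
    ; ⇒adj = λ x y → ⇒adj C _ _ ∘ to-consec
    }
    where open CycleSymmetry σ

  rooted-next : (C : ChordlessCycle G S) {i j : Fin (4 + m C)} → Next i j →
                Σ (ChordlessCycle G S) λ D → c D zero ≡ c C i × c D (suc zero) ≡ c C j
  rooted-next C {i} {j} j≡1+i = reindex C (rotation i) , cong (c C) zero↦i , cong (c C) one↦j
    where
      open ≡-Reasoning
      L : ℕ
      L = 4 + m C
      zero↦i : rotate (toℕ i) zero ≡ i
      zero↦i = toℕ-injective (begin
        toℕ (rotate (toℕ i) zero)   ≡⟨ toℕ-rotate (toℕ i) zero ⟩
        (toℕ i + 0) % L             ≡⟨ cong (_% L) (+-identityʳ (toℕ i)) ⟩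
        toℕ i % L                   ≡⟨ m<n⇒m%n≡m (toℕ<n i) ⟩
        toℕ i                       ∎)
      one↦j : rotate (toℕ i) (suc zero) ≡ j
      one↦j = toℕ-injective (begin
        toℕ (rotate (toℕ i) (suc zero))   ≡⟨ toℕ-rotate (toℕ i) (suc zero) ⟩
        (toℕ i + 1) % L                   ≡⟨ cong (_% L) (+-comm (toℕ i) 1) ⟩
        suc (toℕ i) % L                   ≡⟨ j≡1+i ⟨
        toℕ j                             ∎)

  rooted : (C : ChordlessCycle G S) {i j : Fin (4 + m C)} → Consec i j →
           Σ (ChordlessCycle G S) λ D → c D zero ≡ c C i × c D (suc zero) ≡ c C j
  rooted C (inj₁ j≡1+i) = rooted-next C j≡1+i
  rooted C {i} {j} (inj₂ i≡1+j)
    with D , D₀ , D₁ ← rooted-next (reindex C reflection) {opposite i} {opposite j} (opposite-next {x = j} {y = i} i≡1+j)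
    = D , trans D₀ (cong (c C) (opposite-involutive i)) , trans D₁ (cong (c C) (opposite-involutive j))

  narrow : ∀ {T : Fin n → Set} (C : ChordlessCycle G S) → (∀ x → T (c C x)) → ChordlessCycle G T
  narrow C inT = record { m = m C ; c = c C ; inj = inj C ; inS = inT ; adj⇒ = adj⇒ C ; ⇒adj = ⇒adj C }

inner : ∀ {k} → Fin k → Fin (2 + k)
inner i = suc (inject₁ i)

consec-inject₁-suc : ∀ {k} (i : Fin k) → Consec (inject₁ i) (suc i)
consec-inject₁-suc {k} i =
  inj₁ (≡-sym (trans (cong (λ t → suc t % suc k) (toℕ-inject₁ i)) (m<n⇒m%n≡m (s≤s (toℕ<n i)))))

consec-zero-fromℕ : ∀ k → Consec zero (fromℕ k)
consec-zero-fromℕ k = inj₂ (≡-sym (trans (cong (λ t → suc t % suc k) (toℕ-fromℕ k)) (n%n≡0 (suc k))))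

¬consec-zero-inner-suc : ∀ {k} (i : Fin k) → ¬ Consec zero (inner (suc i))
¬consec-zero-inner-suc i (inj₁ ())
¬consec-zero-inner-suc {k} i (inj₂ e)
  with () ← trans e (m<n⇒m%n≡m (s≤s (s≤s (s≤s (subst (_< k) (≡-sym (toℕ-inject₁ i)) (toℕ<n i))))))

¬consec-one-fromℕ : ∀ k → ¬ Consec (suc zero) (fromℕ (3 + k))
¬consec-one-fromℕ k (inj₁ ())
¬consec-one-fromℕ k (inj₂ e)
  with () ← trans e (trans (cong (λ t → suc t % (4 + k)) (toℕ-fromℕ (3 + k))) (n%n≡0 (4 + k)))

module IsolatedComponent {n} (G : Graph n) (v : Fin n) (Bv I A : Subset n) (z : Fin n)
  (A-component : Component G (InH G v Bv I) A) (z∈A : z ∈ A)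
  (isolated : IsolatedInHhat G v Bv A z) where

  open Component A-component

  ∈A⇒∉Bv : ∀ {a} → a ∈ A → a ∉ Bv
  ∈A⇒∉Bv a∈A = proj₁ (proj₂ (sub _ a∈A))

  non-neighbour-of-v-next-to-A-∈A : ∀ {a b} → a ∈ A → Adj G a b → b ≢ v → ¬ Adj G v b → b ∈ A
  non-neighbour-of-v-next-to-A-∈A {a} {b} a∈A a~b b≢v v≁b with b ∈? Bv
  ... | yes b∈Bv = ⊥-elim (isolated b (inj₂ (b∈Bv , v≁b , (a , a∈A , a~b))))
  ... | no b∉Bv  = closed a b a∈A (b≢v , b∉Bv , v≁b ∘ proj₁) a~b

  neighbour-of-v-next-to-A-∉Bv : ∀ {a w} → a ∈ A → Adj G a w → Adj G v w → ¬ Adj G z w → w ∉ Bv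
  neighbour-of-v-next-to-A-∉Bv {a} {w} a∈A a~w v~w z≁w w∈Bv =
    isolated w (inj₁ (w∈Bv , v~w , (a , a∈A , a~w) , z≁w))

  module _ {S : Fin n → Set} (D : ChordlessCycle G S)
           (D₀ : c D zero ≡ v) (D₁ : c D (suc zero) ≡ z) where

    consec-of-adj : ∀ {u x y} → c D x ≡ u → Adj G u (c D y) → Consec x y
    consec-of-adj refl = adj⇒ D _ _

    inner-∈A : (i : Fin (2 + m D)) → c D (inner i) ∈ A
    inner-∈A = <-weakInduction (λ i → c D (inner i) ∈ A) (subst (_∈ A) (≡-sym D₁) z∈A) successor-∈A
      where
        successor-∈A : ∀ i → c D (inner (inject₁ i)) ∈ A → c D (inner (suc i)) ∈ A
        successor-∈A i a∈A = non-neighbour-of-v-next-to-A-∈A a∈A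
          (⇒adj D _ _ (consec-inject₁-suc (inner i)))
          (λ e → 0≢1+n (inj D _ _ (trans D₀ (≡-sym e))))
          (¬consec-zero-inner-suc i ∘ consec-of-adj D₀)

    last-∉Bv : c D (fromℕ (3 + m D)) ∉ Bv
    last-∉Bv = neighbour-of-v-next-to-A-∉Bv (inner-∈A (fromℕ (1 + m D)))
      (⇒adj D _ _ (consec-inject₁-suc (suc (fromℕ (1 + m D)))))
      (subst (λ u → Adj G u _) D₀ (⇒adj D _ _ (consec-zero-fromℕ (3 + m D))))
      (¬consec-one-fromℕ (m D) ∘ consec-of-adj D₁)

    avoids-Bv : v ∉ Bv → ∀ x → c D x ∉ Bv
    avoids-Bv v∉Bv zero = subst (_∉ Bv) (≡-sym D₀) v∉Bv
    avoids-Bv _ (suc x) with view x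
    ... | ‵fromℕ     = last-∉Bv
    ... | ‵inject₁ i = ∈A⇒∉Bv (inner-∈A i)

lemma3p11 : ∀ {n} (G : Graph n) (EI EM : EdgeSet n) → EdgesOf EI G → EdgesOf EM G →
    (v : Fin n) (Bv : Subset n) → v ∉ Bv → Chordal G (λ u → u ∉ Bv) →
    (I : Subset n) → Independent G I → (∀ u → u ∈ I → NR G EI EM v u) → (∀ u → u ∈ I → u ∉ Bv) →
    (A : Subset n) → Component G (InH G v Bv I) A →
    (z : Fin n) → z ∈ A → z ∈ I →
    IsolatedInHhat G v Bv A z →
    ¬ ChordlessCycleThroughEdge G v z
lemma3p11 G _ _ _ _ v Bv v∉Bv chordal I _ _ _ A A-component z z∈A _ isolated (C , i , j , i~j , Cᵢ≡v , Cⱼ≡z)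
  with D , D₀ , D₁ ← rooted C i~j
  = chordal (narrow D (avoids-Bv D (trans D₀ Cᵢ≡v) (trans D₁ Cⱼ≡z) v∉Bv))
  where open IsolatedComponent G v Bv I A z A-component z∈A isolated
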